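{- Let $n\ge 4$. For every tree $T$ on $n$ vertices that is not isomorphic to the star $S_n$, $H(T)\le H(C_{n,3,1})$; that is, $C_{n,3,1}$ has the second maximum Harary index among trees on $n$ vertices.
   Context: The Harary index of a connected graph $G$ is $H(G)=\sum_{\{x,y\}\subseteq V(G),\,x\ne y}\frac{1}{d(x,y)}$, $d$ the shortest-path distance. $C_{n,3,1}$ is the tree obtained from a path $v_0v_1v_2v_3$ by attaching $n-4$ pendent vertices to $v_1$. -}

module Defs where

open import Data.Nat using (ℕ; zero; suc; _<ᵇ_; _≡ᵇ_; _≤ᵇ_)
open import Data.Bool using (Bool; true; false; _∧_; _∨_; if_then_else_; not)
open import Data.Fin using (Fin; toℕ)
open import Data.Fin.Properties using (_≟_)
open import Data.Fin.Permutation using (Permutation′; _⟨$⟩ʳ_)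
open import Data.List using (List; []; _∷_; _++_; [_]; length; allFin; foldr; map)
open import Data.Bool.ListAction using (any)
open import Data.List.Relation.Unary.Unique.Propositional using (Unique)
open import Data.List.Relation.Unary.Linked using (Linked)
open import Data.Product using (Σ; _×_)
open import Data.Empty using (⊥)
open import Relation.Nullary using (¬_)
open import Relation.Nullary.Decidable using (⌊_⌋)
open import Relation.Binary.PropositionalEquality using (_≡_)
open import Data.Integer using (+_)
open import Data.Rational using (ℚ; _/_; _+_; 0ℚ)
import Data.Nat as ℕ

Graph : ℕ → Set
Graph n = Fin n → Fin n → Bool

Adj : ∀ {n} → Graph n → Fin n → Fin n → Set
Adj G x y = G x y ≡ true

IsSimple : ∀ {n} → Graph n → Set
IsSimple {n} G = ((x y : Fin n) → G x y ≡ G y x) × ((x : Fin n) → G x x ≡ false)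

data Walk {n} (G : Graph n) : Fin n → Fin n → Set where
  nil  : ∀ {x} → Walk G x x
  cons : ∀ {x y z} → Adj G x y → Walk G y z → Walk G x z

Connected : ∀ {n} → Graph n → Set
Connected {n} G = (x y : Fin n) → Walk G x y

Cycle : ∀ {n} → Graph n → Set
Cycle {n} G = Σ (Fin n) λ x → Σ (List (Fin n)) λ vs →
  (3 ℕ.≤ length (x ∷ vs)) × Unique (x ∷ vs) × Linked (Adj G) ((x ∷ vs) ++ [ x ])

Acyclic : ∀ {n} → Graph n → Set
Acyclic G = ¬ Cycle G

IsTree : ∀ {n} → Graph n → Set
IsTree G = IsSimple G × Connected G × Acyclic G

_≅_ : ∀ {n} → Graph n → Graph n → Set
_≅_ {n} G H = Σ (Permutation′ n) λ σ → (x y : Fin n) → G x y ≡ H (σ ⟨$⟩ʳ x) (σ ⟨$⟩ʳ y)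

reach : ∀ {n} → Graph n → ℕ → Fin n → Fin n → Bool
reach G zero x y = ⌊ x ≟ y ⌋
reach {n} G (suc k) x y = reach G k x y ∨ any (λ z → G x z ∧ reach G k z y) (allFin n)

-- least k < m with p k, (m if none)
search : (ℕ → Bool) → ℕ → ℕ
search p zero = zero
search p (suc m) = if p zero then zero else suc (search (λ k → p (suc k)) m)

-- shortest-path distance (least k with a walk of length ≤ k; in a connected
-- graph on n vertices this is < n)
dist : ∀ {n} → Graph n → Fin n → Fin n → ℕ
dist {n} G x y = search (λ k → reach G k x y) n

inv : ℕ → ℚ
inv zero = 0ℚ
inv (suc k) = + 1 / suc k

sumℚ : List ℚ → ℚ
sumℚ = foldr _+_ 0ℚ

harary : ∀ {n} → Graph n → ℚ
harary {n} G = sumℚ (map (λ x → sumℚ (map (λ y →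
  if toℕ x <ᵇ toℕ y then inv (dist G x y) else 0ℚ) (allFin n))) (allFin n))

star : (n : ℕ) → Graph n
star n x y = ((toℕ x ≡ᵇ 0) ∧ not (toℕ y ≡ᵇ 0)) ∨ ((toℕ y ≡ᵇ 0) ∧ not (toℕ x ≡ᵇ 0))

-- C_{n,3,1}: path 0-1-2-3 with pendent vertices 4,…,n-1 attached to 1
c31edge : ℕ → ℕ → Bool
c31edge a b = ((a ≡ᵇ 0) ∧ (b ≡ᵇ 1)) ∨ ((a ≡ᵇ 1) ∧ (b ≡ᵇ 2)) ∨ ((a ≡ᵇ 2) ∧ (b ≡ᵇ 3)) ∨ ((a ≡ᵇ 1) ∧ (4 ≤ᵇ b))

C31 : (n : ℕ) → Graph n
C31 n x y = c31edge (toℕ x) (toℕ y) ∨ c31edge (toℕ y) (toℕ x)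

-- Weight a pair x ≠ y of vertices by w = 6, 3 or 2 according as x and y are adjacent, have a common
-- neighbour, or neither, so that 1/d(x, y) ≤ w/6.  Since w ≤ 2 + 4[x ~ y] + c(x, y), where c counts common
-- neighbours and ∑ c(x, y) over all ordered pairs is ∑ deg², summing gives
-- 12 H(T) ≤ 2n² − 2n + 3 ∑ deg + ∑ deg².  In a tree ∑ deg ≤ 2n − 2, and unless T is a star every degree lies
-- in [1, n − 2], which forces ∑ deg² ≤ n² − 3n + 6; hence 12 H(T) ≤ 3n² + n.  Conversely every pair of
-- vertices of C_{n,3,1} is joined by a walk of length 6/w for an explicit table of weights w whose sum over
-- unordered pairs is (3n² + n)/2, so 12 H(C_{n,3,1}) ≥ 3n² + n.

module Submission where

open import Defs
open import Data.Nat using (ℕ; zero; suc; _+_; _*_; _∸_; _≤_; _<_; z≤n; s≤s; _<ᵇ_; _≡ᵇ_)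
open import Data.Nat.Properties hiding (_≟_)
open import Data.Nat.Tactic.RingSolver using (solve-∀)
open import Data.Fin using (Fin; zero; suc; toℕ; inject₁; fromℕ)
open import Data.Fin.Patterns using (0F; 1F; 2F; 3F)
open import Data.Fin.Permutation using (transpose; _⟨$⟩ʳ_)
import Data.Fin.Properties as Fin
open import Data.Fin.Properties using (_≟_; any?; toℕ<n; toℕ-injective; injective⇒≤; toℕ-inject₁; toℕ-fromℕ)
open import Data.Bool using (Bool; true; false; _∧_; _∨_; not; if_then_else_; T)
open import Data.Bool.Properties using (T-≡; ¬-not; ∨-zeroʳ) renaming (_≟_ to _≟ᵇ_)
open import Data.Bool.ListAction using (any)
open import Data.List using (List; []; _∷_; _++_; [_]; allFin; length; lookup; map; tabulate)
open import Data.List.Properties using (map-tabulate)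
open import Data.List.Relation.Unary.All as All using (All; []; _∷_)
open import Data.List.Relation.Unary.AllPairs using ([]; _∷_)
open import Data.List.Relation.Unary.Unique.Propositional using (Unique)
open import Data.List.Relation.Unary.Linked using (Linked; [-]; _∷_)
open import Data.List.Relation.Unary.Any using (here; there; satisfied)
import Data.List.Relation.Unary.Any as Any
open import Data.List.Relation.Unary.All.Properties using (¬Any⇒All¬)
open import Data.List.Relation.Unary.Any.Properties using (any⁺; any⁻)
open import Data.List.Membership.Propositional using (_∈_; lose)
open import Data.List.Membership.Propositional.Properties using (∈-allFin; ∈-lookup)
open import Data.Product using (Σ; ∃; _×_; _,_; proj₂)
import Data.Product as Product
open import Data.Sum using (_⊎_; inj₁; inj₂)
import Data.Sum as Sum
open import Function using (_∘_; id; Equivalence)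
open import Relation.Nullary using (¬_; yes; no; does; contradiction; ofʸ; ofⁿ; ¬?; _×-dec_)
open import Relation.Nullary.Decidable using (dec-false)
open import Relation.Binary.PropositionalEquality hiding ([_])
import Data.Integer as ℤ
open import Data.Integer using (ℤ)
open import Data.Integer.Tactic.RingSolver using () renaming (solve-∀ to ℤ-solve-∀)
import Data.Integer.Properties as ℤ
open import Data.Rational using (ℚ; _/_; 0ℚ; toℚᵘ) renaming (_≤_ to _≤ℚ_; _+_ to _+ℚ_)
open import Data.Rational.Properties using (toℚᵘ-fromℚᵘ; toℚᵘ-cancel-≤; toℚᵘ-injective; toℚᵘ-homo-+)
import Data.Rational.Properties as ℚ
open import Data.Rational.Unnormalised using (mkℚᵘ; *≤*; *≡*) renaming (_+_ to _+ᵘ_)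
import Data.Rational.Unnormalised.Properties as ℚᵘ
open import Algebra.Properties.Semiring.Sum +-*-semiring
  using (sum; sum-syntax; sum-init-last; ∑-distrib-+; ∑-comm; sum-cong-≗; *-distribˡ-sum; *-distribʳ-sum)

𝟙 : Bool → ℕ
𝟙 true  = 1
𝟙 false = 0

𝟙-idem : ∀ b → 𝟙 b * 𝟙 b ≡ 𝟙 b
𝟙-idem true  = refl
𝟙-idem false = refl

∑-mono-≤ : ∀ {n} {f g : Fin n → ℕ} → (∀ i → f i ≤ g i) → sum f ≤ sum g
∑-mono-≤ {zero}  f≤g = z≤n
∑-mono-≤ {suc n} f≤g = +-mono-≤ (f≤g zero) (∑-mono-≤ (f≤g ∘ suc))

∑-const : ∀ n c → ∑[ i < n ] c ≡ n * c
∑-const zero    c = refl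
∑-const (suc n) c = cong (c +_) (∑-const n c)

∑-zero : ∀ n → ∑[ i < n ] 0 ≡ 0
∑-zero n = trans (∑-const n 0) (*-zeroʳ n)

≤-∑ : ∀ {n} (f : Fin n → ℕ) i → f i ≤ sum f
≤-∑ f zero    = m≤m+n _ _
≤-∑ f (suc i) = ≤-trans (≤-∑ (f ∘ suc) i) (m≤n+m _ _)

∑-δ : ∀ {n} (x : Fin n) (g : Fin n → ℕ) → ∑[ y < n ] (𝟙 (does (y ≟ x)) * g y) ≡ g x
∑-δ {suc n} zero g = begin
  g zero + 0 + ∑[ y < n ] 0 ≡⟨ cong (g zero + 0 +_) (∑-zero n) ⟩
  g zero + 0 + 0            ≡⟨ +-identityʳ _ ⟩
  g zero + 0                ≡⟨ +-identityʳ _ ⟩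
  g zero                    ∎
  where open ≡-Reasoning
∑-δ {suc n} (suc x) g = ∑-δ {n} x (g ∘ suc)

∑-sq≤sq-∑ : ∀ {n} (e : Fin n → ℕ) → ∑[ i < n ] (e i * e i) ≤ sum e * sum e
∑-sq≤sq-∑ {zero}  e = z≤n
∑-sq≤sq-∑ {suc n} e = begin
  a * a + ∑[ i < n ] (e (suc i) * e (suc i)) ≤⟨ +-monoʳ-≤ (a * a) (∑-sq≤sq-∑ (e ∘ suc)) ⟩
  a * a + s * s                              ≤⟨ m≤m+n _ (2 * a * s) ⟩
  a * a + s * s + 2 * a * s                  ≡⟨ square a s ⟩
  (a + s) * (a + s)                          ∎
  where
  open ≤-Reasoning
  a = e zero
  s = sum (e ∘ suc)
  square : ∀ a s → a * a + s * s + 2 * a * s ≡ (a + s) * (a + s)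
  square = solve-∀

-- A nonzero first term a leaves at most M + 1 - a for the rest, and a² + (M + 1 - a)² ≤ M² + 1.
∑-sq-bound : ∀ {n} (e : Fin n → ℕ) M → (∀ i → e i ≤ M) → sum e ≤ suc M →
             ∑[ i < n ] (e i * e i) ≤ M * M + 1
∑-sq-bound {zero}  e M e≤M ∑e≤ = z≤n
∑-sq-bound {suc n} e M e≤M ∑e≤ with e zero in e₀
... | zero  = ∑-sq-bound (e ∘ suc) M (e≤M ∘ suc) ∑e≤
... | suc a = begin
  suc a * suc a + ∑[ i < n ] (e (suc i) * e (suc i)) ≤⟨ +-monoʳ-≤ _ (∑-sq≤sq-∑ (e ∘ suc)) ⟩
  suc a * suc a + s * s                              ≤⟨ +-monoʳ-≤ _ (*-mono-≤ s≤ s≤) ⟩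
  suc a * suc a + suc c * suc c                      ≤⟨ m≤m+n _ (2 * a * c) ⟩
  suc a * suc a + suc c * suc c + 2 * a * c          ≡⟨ square a c ⟩
  (suc a + c) * (suc a + c) + 1                      ≡⟨ cong (λ t → t * t + 1) a+c≡M ⟩
  M * M + 1                                          ∎
  where
  open ≤-Reasoning
  s = sum (e ∘ suc)
  c = M ∸ suc a
  a+c≡M : suc a + c ≡ M
  a+c≡M = m+[n∸m]≡n (subst (_≤ M) e₀ (e≤M zero))
  s≤ : s ≤ suc c
  s≤ = +-cancelˡ-≤ (suc a) s (suc c)
         (≤-trans ∑e≤ (≤-reflexive (trans (cong suc (sym a+c≡M)) (sym (+-suc (suc a) c)))))
  square : ∀ a c → suc a * suc a + suc c * suc c + 2 * a * c ≡ (suc a + c) * (suc a + c) + 1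
  square = solve-∀

∑-snoc-toℕ : ∀ N (g : ℕ → ℕ) → ∑[ i < suc N ] g (toℕ i) ≡ ∑[ i < N ] g (toℕ i) + g N
∑-snoc-toℕ N g = begin
  ∑[ i < suc N ] g (toℕ i)
    ≡⟨ sum-init-last {N} (g ∘ toℕ) ⟩
  ∑[ i < N ] g (toℕ (inject₁ i)) + g (toℕ (fromℕ N))
    ≡⟨ cong₂ _+_ (sum-cong-≗ {N} (λ i → cong g (toℕ-inject₁ i))) (cong g (toℕ-fromℕ N)) ⟩
  ∑[ i < N ] g (toℕ i) + g N
    ∎
  where open ≡-Reasoning

-- Degrees d = 1 + e of a non-star tree: ∑ e ≤ n - 2 and e ≤ n - 3 pointwise, so ∑ e² ≤ (n - 3)² + 1.
degree-sequence-bound : ∀ {n} → 3 ≤ n → (d : Fin n → ℕ) → (∀ z → 1 ≤ d z) → (∀ z → d z ≤ n ∸ 2) →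
                        sum d ≤ 2 * (n ∸ 1) → 3 * sum d + ∑[ z < n ] (d z * d z) ≤ n * n + 3 * n
degree-sequence-bound {n} (s≤s (s≤s (s≤s {n = k} z≤n))) d 1≤d d≤ ∑d≤ = begin
  3 * sum d + ∑[ z < n ] (d z * d z)  ≡⟨ cong₂ (λ a b → 3 * a + b) ∑d≡ ∑d²≡ ⟩
  3 * (n * 1 + E) + (SE + 2 * E + n * 1) ≡⟨ regroup n E SE ⟩
  4 * n + 5 * E + SE                  ≤⟨ +-mono-≤ (+-monoʳ-≤ (4 * n) (*-monoʳ-≤ 5 E≤)) SE≤ ⟩
  4 * n + 5 * suc k + (k * k + 1)     ≡⟨ regroup′ k ⟩
  n * n + 3 * n                       ∎
  where
  open ≤-Reasoning
  e : Fin n → ℕ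
  e z = d z ∸ 1
  E SE : ℕ
  E  = sum e
  SE = ∑[ z < n ] (e z * e z)
  d≡ : ∀ z → d z ≡ 1 + e z
  d≡ z = sym (m+[n∸m]≡n (1≤d z))
  ∑d≡ : sum d ≡ n * 1 + E
  ∑d≡ = trans (sum-cong-≗ d≡) (trans (∑-distrib-+ (λ _ → 1) e) (cong (_+ E) (∑-const n 1)))
  ∑d²≡ : ∑[ z < n ] (d z * d z) ≡ SE + 2 * E + n * 1
  ∑d²≡ = begin-equality
    ∑[ z < n ] (d z * d z)                        ≡⟨ sum-cong-≗ (λ z → trans (cong₂ _*_ (d≡ z) (d≡ z)) (square (e z))) ⟩
    ∑[ z < n ] (e z * e z + 2 * e z + 1)          ≡⟨ ∑-distrib-+ (λ z → e z * e z + 2 * e z) (λ _ → 1) ⟩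
    ∑[ z < n ] (e z * e z + 2 * e z) + ∑[ z < n ] 1
      ≡⟨ cong₂ _+_ (trans (∑-distrib-+ (λ z → e z * e z) (λ z → 2 * e z)) (cong (SE +_) (sym (*-distribˡ-sum 2 e))))
                   (∑-const n 1) ⟩
    SE + 2 * E + n * 1                            ∎
    where
    square : ∀ a → (1 + a) * (1 + a) ≡ a * a + 2 * a + 1
    square = solve-∀
  E≤ : E ≤ suc k
  E≤ = +-cancelˡ-≤ (n * 1) E (suc k) (subst₂ _≤_ ∑d≡ (sym (split k)) ∑d≤)
    where
    split : ∀ k → (3 + k) * 1 + suc k ≡ 2 * (2 + k)
    split = solve-∀
  SE≤ : SE ≤ k * k + 1
  SE≤ = ∑-sq-bound e k (λ z → ∸-monoˡ-≤ 1 (d≤ z)) E≤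
  regroup : ∀ n E SE → 3 * (n * 1 + E) + (SE + 2 * E + n * 1) ≡ 4 * n + 5 * E + SE
  regroup = solve-∀
  regroup′ : ∀ k → 4 * (3 + k) + 5 * suc k + (k * k + 1) ≡ (3 + k) * (3 + k) + 3 * (3 + k)
  regroup′ = solve-∀

lookup-injective : ∀ {A : Set} {xs : List A} → Unique xs → ∀ {i j} → lookup xs i ≡ lookup xs j → i ≡ j
lookup-injective (_   ∷ _) {zero}  {zero}  _  = refl
lookup-injective (x∉ ∷ _) {zero}  {suc j} eq = contradiction eq (All.lookup x∉ (∈-lookup j))
lookup-injective (x∉ ∷ _) {suc i} {zero}  eq = contradiction (sym eq) (All.lookup x∉ (∈-lookup i))
lookup-injective (_   ∷ u) {suc i} {suc j} eq = cong suc (lookup-injective u eq)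

unique-length≤ : ∀ {n} {xs : List (Fin n)} → Unique xs → length xs ≤ n
unique-length≤ u = injective⇒≤ (lookup-injective u)

prefixTo : ∀ {A : Set} {w : A} {xs : List A} → w ∈ xs → List A
prefixTo {xs = x ∷ _} (here _)  = [ x ]
prefixTo {xs = x ∷ _} (there p) = x ∷ prefixTo p

module _ {A : Set} {w : A} where

  All-prefixTo : ∀ {P : A → Set} {xs} → All P xs → (p : w ∈ xs) → All P (prefixTo p)
  All-prefixTo (px ∷ _)   (here _)  = px ∷ []
  All-prefixTo (px ∷ pxs) (there p) = px ∷ All-prefixTo pxs p

  Unique-prefixTo : ∀ {xs} → Unique xs → (p : w ∈ xs) → Unique (prefixTo p)
  Unique-prefixTo (_   ∷ _) (here _)  = [] ∷ []
  Unique-prefixTo (x∉ ∷ u) (there p) = All-prefixTo x∉ p ∷ Unique-prefixTo u p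

  Linked-prefixTo-∷ʳ : ∀ {R : A → A → Set} {xs x} → Linked R xs → (p : w ∈ xs) → R w x →
                       Linked R (prefixTo p ++ [ x ])
  Linked-prefixTo-∷ʳ _          (here refl)         r = r ∷ [-]
  Linked-prefixTo-∷ʳ (r′ ∷ _)   (there (here refl)) r = r′ ∷ r ∷ [-]
  Linked-prefixTo-∷ʳ (r′ ∷ rs)  (there (there p))   r = r′ ∷ Linked-prefixTo-∷ʳ rs (there p) r

  prefixTo-nonempty : ∀ {xs} (p : w ∈ xs) → 1 ≤ length (prefixTo p)
  prefixTo-nonempty (here _)  = s≤s z≤n
  prefixTo-nonempty (there _) = s≤s z≤n

∧-true⁻ : ∀ {a b} → a ∧ b ≡ true → a ≡ true × b ≡ true
∧-true⁻ {true} b≡true = refl , b≡true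

any-allFin⁺ : ∀ {n} (p : Fin n → Bool) {x} → p x ≡ true → any p (allFin n) ≡ true
any-allFin⁺ p {x} px = Equivalence.to T-≡ (any⁺ p (lose (∈-allFin x) (Equivalence.from T-≡ px)))

any-allFin⁻ : ∀ {n} (p : Fin n → Bool) → any p (allFin n) ≡ true → ∃ λ x → p x ≡ true
any-allFin⁻ p h = Product.map₂ (Equivalence.to T-≡) (satisfied (any⁻ p (allFin _) (Equivalence.from T-≡ h)))

search-≤ : ∀ m (p : ℕ → Bool) {k} → p k ≡ true → search p m ≤ k
search-≤ zero    p pk = z≤n
search-≤ (suc m) p pk with p zero in p₀
... | true = z≤n
search-≤ (suc m) p {zero}  pk | false = contradiction (trans (sym p₀) pk) λ ()
search-≤ (suc m) p {suc k} pk | false = s≤s (search-≤ m (p ∘ suc) pk)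

search-≥ : ∀ m (p : ℕ → Bool) {k} → k ≤ m → (∀ j → j < k → p j ≡ false) → k ≤ search p m
search-≥ m       p {zero}  _         _     = z≤n
search-≥ (suc m) p {suc k} (s≤s k≤m) below rewrite below 0 (s≤s z≤n) =
  s≤s (search-≥ m (p ∘ suc) k≤m (λ j j<k → below (suc j) (s≤s j<k)))

-- The weight 6 / min(d, 3) of a pair at distance d, read off from adjacency and the number of common neighbours.
distWeight : Bool → ℕ → ℕ
distWeight true  _       = 6
distWeight false zero    = 2
distWeight false (suc _) = 3

distWeight-≤ : ∀ a c → distWeight a c ≤ 2 + 4 * 𝟙 a + c
distWeight-≤ true  c       = m≤m+n 6 c
distWeight-≤ false zero    = ≤-refl
distWeight-≤ false (suc c) = s≤s (s≤s (s≤s z≤n))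

module _ {n} (G : Graph n) where

  walkLength : ∀ {x y} → Walk G x y → ℕ
  walkLength nil        = 0
  walkLength (cons _ w) = suc (walkLength w)

  reach-suc : ∀ {k x y} → reach G k x y ≡ true → reach G (suc k) x y ≡ true
  reach-suc r rewrite r = refl

  reach-mono : ∀ {j k x y} → j ≤ k → reach G j x y ≡ true → reach G k x y ≡ true
  reach-mono {k = zero}  z≤n  r = r
  reach-mono {k = suc k} j≤k+1 r with m≤n⇒m<n∨m≡n j≤k+1
  ... | inj₁ (s≤s j≤k) = reach-suc {k} (reach-mono j≤k r)
  ... | inj₂ refl      = r

  reach-step : ∀ k {x z y} → Adj G x z → reach G k z y ≡ true → reach G (suc k) x y ≡ true
  reach-step k {x} xz zy =
    trans (cong (reach G k x _ ∨_) (any-allFin⁺ (λ z → G x z ∧ reach G k z _) (cong₂ _∧_ xz zy)))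
          (∨-zeroʳ _)

  reach-walk : ∀ {x y} (w : Walk G x y) → reach G (walkLength w) x y ≡ true
  reach-walk {x} nil with x ≟ x
  ... | yes _   = refl
  ... | no x≢x = contradiction refl x≢x
  reach-walk (cons xz w) = reach-step (walkLength w) xz (reach-walk w)

  reach-zero⁻ : ∀ {x y} → reach G 0 x y ≡ true → x ≡ y
  reach-zero⁻ {x} {y} r with x ≟ y
  ... | yes x≡y = x≡y

  reach-suc⁻ : ∀ k {x y} → reach G (suc k) x y ≡ true →
               reach G k x y ≡ true ⊎ ∃ λ z → Adj G x z × reach G k z y ≡ true
  reach-suc⁻ k {x} {y} r with reach G k x y
  ... | true  = inj₁ refl
  ... | false = inj₂ (Product.map₂ ∧-true⁻ (any-allFin⁻ (λ z → G x z ∧ reach G k z y) r))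

  reach-one⁻ : ∀ {x y} → reach G 1 x y ≡ true → x ≡ y ⊎ Adj G x y
  reach-one⁻ r with reach-suc⁻ 0 r
  ... | inj₁ r₀            = inj₁ (reach-zero⁻ r₀)
  ... | inj₂ (z , xz , r₀) = inj₂ (subst (Adj G _) (reach-zero⁻ r₀) xz)

  reach-two⁻ : ∀ {x y} → reach G 2 x y ≡ true →
               x ≡ y ⊎ Adj G x y ⊎ ∃ λ z → Adj G x z × Adj G z y
  reach-two⁻ r with reach-suc⁻ 1 r
  ... | inj₁ r₁ = Sum.map₂ inj₁ (reach-one⁻ r₁)
  ... | inj₂ (z , xz , r₁) with reach-one⁻ r₁
  ...   | inj₁ z≡y = inj₂ (inj₁ (subst (Adj G _) z≡y xz))
  ...   | inj₂ zy  = inj₂ (inj₂ (z , xz , zy))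

  dist-≤ : ∀ {k x y} → reach G k x y ≡ true → dist G x y ≤ k
  dist-≤ = search-≤ n _

  dist-≥ : ∀ {k x y} → k < n → ¬ reach G k x y ≡ true → suc k ≤ dist G x y
  dist-≥ k<n ¬r = search-≥ n _ k<n (λ j j≤k → ¬-not (¬r ∘ reach-mono (≤-pred j≤k)))

  dist-pos : ∀ {x y} → x ≢ y → 1 ≤ dist G x y
  dist-pos {x} x≢y = dist-≥ (≤-<-trans z≤n (toℕ<n x)) (x≢y ∘ reach-zero⁻)

  deg : Fin n → ℕ
  deg x = ∑[ y < n ] 𝟙 (G x y)

  common : Fin n → Fin n → ℕ
  common x y = ∑[ z < n ] (𝟙 (G x z) * 𝟙 (G z y))

  common-pos : ∀ {x y z} → Adj G x z → Adj G z y → 1 ≤ common x y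
  common-pos {z = z} xz zy =
    ≤-trans (≤-reflexive (cong₂ (λ a b → 𝟙 a * 𝟙 b) (sym xz) (sym zy))) (≤-∑ _ z)

  pairWeight : Fin n → Fin n → ℕ
  pairWeight x y = distWeight (G x y) (common x y)

  module _ (symmetric : ∀ x y → G x y ≡ G y x) where

    common-sym : ∀ x y → common x y ≡ common y x
    common-sym x y = sum-cong-≗ λ z →
      trans (cong₂ (λ a b → 𝟙 a * 𝟙 b) (symmetric x z) (symmetric z y)) (*-comm (𝟙 (G z x)) _)

    pairWeight-sym : ∀ x y → pairWeight x y ≡ pairWeight y x
    pairWeight-sym x y = cong₂ distWeight (symmetric x y) (common-sym x y)

    common-diag : ∀ x → common x x ≡ deg x
    common-diag x = sum-cong-≗ λ z → trans (cong (λ b → 𝟙 (G x z) * 𝟙 b) (symmetric z x)) (𝟙-idem (G x z))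

    ∑∑-common : ∑[ x < n ] ∑[ y < n ] common x y ≡ ∑[ z < n ] (deg z * deg z)
    ∑∑-common = begin
      ∑[ x < n ] ∑[ y < n ] ∑[ z < n ] (𝟙 (G x z) * 𝟙 (G z y))
        ≡⟨ sum-cong-≗ (λ x → ∑-comm (λ y z → 𝟙 (G x z) * 𝟙 (G z y))) ⟩
      ∑[ x < n ] ∑[ z < n ] ∑[ y < n ] (𝟙 (G x z) * 𝟙 (G z y))
        ≡⟨ sum-cong-≗ (λ x → sum-cong-≗ (λ z → sym (*-distribˡ-sum (𝟙 (G x z)) (λ y → 𝟙 (G z y))))) ⟩
      ∑[ x < n ] ∑[ z < n ] (𝟙 (G x z) * deg z)
        ≡⟨ ∑-comm (λ x z → 𝟙 (G x z) * deg z) ⟩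
      ∑[ z < n ] ∑[ x < n ] (𝟙 (G x z) * deg z)
        ≡⟨ sum-cong-≗ (λ z → sym (*-distribʳ-sum (deg z) (λ x → 𝟙 (G x z)))) ⟩
      ∑[ z < n ] (∑[ x < n ] 𝟙 (G x z) * deg z)
        ≡⟨ sum-cong-≗ (λ z → cong (_* deg z) (sum-cong-≗ (λ x → cong 𝟙 (symmetric x z)))) ⟩
      ∑[ z < n ] (deg z * deg z)
        ∎
      where open ≡-Reasoning

  -- dist saturates at n when there is no short walk, hence the hypothesis 2 < n.
  pairWeight-dist : 2 < n → ∀ {x y} → x ≢ y → 6 ≤ pairWeight x y * dist G x y
  pairWeight-dist 2<n {x} {y} x≢y with G x y in xy | common x y in cxy
  ... | true  | _     = *-monoʳ-≤ 6 (dist-pos x≢y)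
  ... | false | suc _ = *-monoʳ-≤ 3 (dist-≥ (<⇒≤ 2<n) ¬reach₁)
    where
    ¬reach₁ : ¬ reach G 1 x y ≡ true
    ¬reach₁ r with reach-one⁻ r
    ... | inj₁ x≡y = x≢y x≡y
    ... | inj₂ xy′ = contradiction (trans (sym xy) xy′) λ ()
  ... | false | zero  = *-monoʳ-≤ 2 (dist-≥ 2<n ¬reach₂)
    where
    ¬reach₂ : ¬ reach G 2 x y ≡ true
    ¬reach₂ r with reach-two⁻ r
    ... | inj₁ x≡y               = x≢y x≡y
    ... | inj₂ (inj₁ xy′)        = contradiction (trans (sym xy) xy′) λ ()
    ... | inj₂ (inj₂ (_ , xz , zy)) = contradiction (subst (1 ≤_) cxy (common-pos xz zy)) λ ()

offDiagSum : ∀ {n} → (Fin n → Fin n → ℕ) → ℕ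
offDiagSum {n} w = ∑[ x < n ] ∑[ y < n ] (𝟙 (not (does (y ≟ x))) * w x y)

upper : ∀ {n} → (Fin n → Fin n → ℕ) → Fin n → Fin n → ℕ
upper w x y = if toℕ x <ᵇ toℕ y then w x y else 0

upperSum : ∀ {n} → (Fin n → Fin n → ℕ) → ℕ
upperSum {n} w = ∑[ x < n ] ∑[ y < n ] upper w x y

module _ {n} {w : Fin n → Fin n → ℕ} (w-sym : ∀ x y → w x y ≡ w y x) where

  upper-pair : ∀ x y → upper w x y + upper w y x ≡ 𝟙 (not (does (y ≟ x))) * w x y
  upper-pair x y with toℕ x <ᵇ toℕ y | <ᵇ-reflects-< (toℕ x) (toℕ y)
                    | toℕ y <ᵇ toℕ x | <ᵇ-reflects-< (toℕ y) (toℕ x) | y ≟ x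
  ... | true  | ofʸ x<y | true  | ofʸ y<x | _        = contradiction x<y (<-asym y<x)
  ... | true  | ofʸ x<y | false | _       | yes refl = contradiction x<y (<-irrefl refl)
  ... | true  | _       | false | _       | no _     = refl
  ... | false | _       | true  | ofʸ y<x | yes refl = contradiction y<x (<-irrefl refl)
  ... | false | _       | true  | _       | no _     = trans (w-sym y x) (sym (+-identityʳ _))
  ... | false | _       | false | _       | yes _    = refl
  ... | false | ofⁿ x≮y | false | ofⁿ y≮x | no y≢x   =
    contradiction (toℕ-injective (≤-antisym (≮⇒≥ x≮y) (≮⇒≥ y≮x))) y≢x

  offDiagSum≡2*upperSum : offDiagSum w ≡ 2 * upperSum w
  offDiagSum≡2*upperSum = sym (begin
    2 * upperSum w                   ≡⟨ cong (upperSum w +_) (+-identityʳ _) ⟩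
    upperSum w + upperSum w          ≡⟨ cong (upperSum w +_) (∑-comm (upper w)) ⟩
    upperSum w + ∑[ x < n ] ∑[ y < n ] upper w y x
      ≡⟨ sym (∑-distrib-+ (λ x → ∑[ y < n ] upper w x y) (λ x → ∑[ y < n ] upper w y x)) ⟩
    ∑[ x < n ] (∑[ y < n ] upper w x y + ∑[ y < n ] upper w y x)
      ≡⟨ sum-cong-≗ (λ x → sym (∑-distrib-+ (upper w x) (λ y → upper w y x))) ⟩
    ∑[ x < n ] ∑[ y < n ] (upper w x y + upper w y x)
      ≡⟨ sum-cong-≗ (λ x → sum-cong-≗ (upper-pair x)) ⟩
    offDiagSum w ∎)
    where open ≡-Reasoning

-- Degree sums of forests

module Induced {n} (G : Graph n) (symmetric : ∀ x y → G x y ≡ G y x) (loopless : ∀ x → G x x ≡ false) where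

  size : (Fin n → Bool) → ℕ
  size s = ∑[ x < n ] 𝟙 (s x)

  degIn : (Fin n → Bool) → Fin n → ℕ
  degIn s v = ∑[ y < n ] 𝟙 (s y ∧ G v y)

  degSumIn : (Fin n → Bool) → ℕ
  degSumIn s = ∑[ x < n ] ∑[ y < n ] 𝟙 (s x ∧ s y ∧ G x y)

  remove : (Fin n → Bool) → Fin n → Fin n → Bool
  remove s v x = s x ∧ not (does (x ≟ v))

  module _ {s : Fin n → Bool} {v : Fin n} (v∈s : s v ≡ true) where

    edge-remove : ∀ x y → 𝟙 (s x ∧ s y ∧ G x y)
      ≡ 𝟙 ((s x ∧ not (does (x ≟ v))) ∧ (s y ∧ not (does (y ≟ v))) ∧ G x y)
        + (𝟙 (does (x ≟ v)) * 𝟙 (s y ∧ G v y) + 𝟙 (does (y ≟ v)) * 𝟙 (s x ∧ G v x))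
    edge-remove x y with x ≟ v | y ≟ v
    ... | yes refl | yes refl rewrite loopless x | v∈s = refl
    ... | yes refl | no _ rewrite v∈s with s y | G x y
    ...   | true  | true  = refl
    ...   | true  | false = refl
    ...   | false | _     = refl
    edge-remove x y | no _ | yes refl rewrite v∈s | symmetric x y with s x | G y x
    ...   | true  | true  = refl
    ...   | true  | false = refl
    ...   | false | _     = refl
    edge-remove x y | no _ | no _ with s x | s y | G x y
    ...   | true  | true  | true  = refl
    ...   | true  | true  | false = refl
    ...   | true  | false | _     = refl
    ...   | false | _     | _     = refl

    degSumIn-remove : degSumIn s ≡ degSumIn (remove s v) + 2 * degIn s v
    degSumIn-remove = begin
      degSumIn s
        ≡⟨ sum-cong-≗ (λ x → sum-cong-≗ (edge-remove x)) ⟩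
      ∑[ x < n ] ∑[ y < n ] (a x y + (b x y + c x y))
        ≡⟨ sum-cong-≗ (λ x → trans (∑-distrib-+ (a x) _) (cong (∑[ y < n ] a x y +_) (∑-distrib-+ (b x) (c x)))) ⟩
      ∑[ x < n ] (∑[ y < n ] a x y + (∑[ y < n ] b x y + ∑[ y < n ] c x y))
        ≡⟨ trans (∑-distrib-+ (λ x → ∑[ y < n ] a x y) (λ x → ∑[ y < n ] b x y + ∑[ y < n ] c x y))
               (cong (degSumIn (remove s v) +_) (∑-distrib-+ (λ x → ∑[ y < n ] b x y) (λ x → ∑[ y < n ] c x y))) ⟩
      degSumIn (remove s v) + (∑[ x < n ] ∑[ y < n ] b x y + ∑[ x < n ] ∑[ y < n ] c x y)
        ≡⟨ cong (degSumIn (remove s v) +_) (cong₂ _+_ ∑∑b ∑∑c) ⟩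
      degSumIn (remove s v) + (degIn s v + degIn s v)
        ≡⟨ cong (λ t → degSumIn (remove s v) + (degIn s v + t)) (sym (+-identityʳ _)) ⟩
      degSumIn (remove s v) + 2 * degIn s v ∎
      where
      open ≡-Reasoning
      a b c : Fin n → Fin n → ℕ
      a x y = 𝟙 (remove s v x ∧ remove s v y ∧ G x y)
      b x y = 𝟙 (does (x ≟ v)) * 𝟙 (s y ∧ G v y)
      c x y = 𝟙 (does (y ≟ v)) * 𝟙 (s x ∧ G v x)
      ∑∑b : ∑[ x < n ] ∑[ y < n ] b x y ≡ degIn s v
      ∑∑b = trans (sum-cong-≗ (λ x → sym (*-distribˡ-sum (𝟙 (does (x ≟ v))) (λ y → 𝟙 (s y ∧ G v y)))))
                  (∑-δ v (λ _ → degIn s v))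
      ∑∑c : ∑[ x < n ] ∑[ y < n ] c x y ≡ degIn s v
      ∑∑c = sum-cong-≗ (λ x → ∑-δ v (λ _ → 𝟙 (s x ∧ G v x)))

    size-remove : size s ≡ suc (size (remove s v))
    size-remove = begin
      size s                                                 ≡⟨ sum-cong-≗ split ⟩
      ∑[ x < n ] (𝟙 (does (x ≟ v)) * 1 + 𝟙 (remove s v x))  ≡⟨ ∑-distrib-+ (λ x → 𝟙 (does (x ≟ v)) * 1) (λ x → 𝟙 (remove s v x)) ⟩
      ∑[ x < n ] (𝟙 (does (x ≟ v)) * 1) + size (remove s v)  ≡⟨ cong (_+ size (remove s v)) (∑-δ v (λ _ → 1)) ⟩
      suc (size (remove s v))                                ∎
      where
      open ≡-Reasoning
      split : ∀ x → 𝟙 (s x) ≡ 𝟙 (does (x ≟ v)) * 1 + 𝟙 (s x ∧ not (does (x ≟ v)))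
      split x with x ≟ v
      ... | yes refl rewrite v∈s = refl
      ... | no _ with s x
      ...   | true  = refl
      ...   | false = refl

  degIn-≤-size : ∀ s v → degIn s v ≤ size (remove s v)
  degIn-≤-size s v = ∑-mono-≤ pointwise
    where
    pointwise : ∀ y → 𝟙 (s y ∧ G v y) ≤ 𝟙 (s y ∧ not (does (y ≟ v)))
    pointwise y with y ≟ v
    ... | yes refl rewrite loopless y with s y
    ...   | true  = z≤n
    ...   | false = z≤n
    pointwise y | no _ with s y | G v y
    ...   | true  | true  = s≤s z≤n
    ...   | true  | false = z≤n
    ...   | false | _     = z≤n

  module _ (s : Fin n → Bool) (minDeg : ∀ v → s v ≡ true → 2 ≤ degIn s v) where

    other-neighbour : ∀ {v} u → s v ≡ true → ∃ λ w → s w ≡ true × Adj G v w × w ≢ u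
    other-neighbour {v} u v∈s with any? (λ w → (s w ≟ᵇ true) ×-dec (G v w ≟ᵇ true) ×-dec ¬? (w ≟ u))
    ... | yes found = found
    ... | no ∄w = contradiction (≤-trans (minDeg v v∈s) degIn≤1) λ { (s≤s ()) }
      where
      pointwise : ∀ y → 𝟙 (s y ∧ G v y) ≤ 𝟙 (does (y ≟ u)) * 1
      pointwise y with s y in y∈s | G v y in vy | y ≟ u
      ... | true  | true  | yes _  = ≤-refl
      ... | true  | true  | no y≢u = contradiction (y , y∈s , vy , y≢u) ∄w
      ... | true  | false | _      = z≤n
      ... | false | _     | _      = z≤n
      degIn≤1 : degIn s v ≤ 1
      degIn≤1 = ≤-trans (∑-mono-≤ pointwise) (≤-reflexive (∑-δ u (λ _ → 1)))

    previous : Fin n → List (Fin n) → Fin n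
    previous v []      = v
    previous v (u ∷ _) = u

    -- v ∷ rest is a path inside s, newest vertex first.  Minimum degree two lets it grow at v away from
    -- the previous vertex until it runs into itself, which must happen before it exceeds n vertices.
    grow : ∀ fuel v rest → s v ≡ true → Unique (v ∷ rest) → Linked (Adj G) (v ∷ rest) →
           length (v ∷ rest) + fuel ≡ suc n → Cycle G
    grow zero v rest _ u _ len =
      contradiction (subst (_≤ n) (trans (sym (+-identityʳ _)) len) (unique-length≤ u)) 1+n≰n
    grow (suc fuel) v rest v∈s u l len with other-neighbour (previous v rest) v∈s
    ... | w , w∈s , vw , w≢prev with Any.any? (w ≟_) (v ∷ rest)
    ...   | no w∉path =
      grow fuel w (v ∷ rest) w∈s (¬Any⇒All¬ (v ∷ rest) w∉path ∷ u) (trans (symmetric w v) vw ∷ l)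
           (trans (sym (+-suc (length (v ∷ rest)) fuel)) len)
    ...   | yes (here refl) = contradiction (trans (sym vw) (loopless v)) λ ()
    grow (suc fuel) v (u′ ∷ rest) v∈s u l len | w , w∈s , vw , w≢prev | yes (there (here refl)) =
      contradiction refl w≢prev
    grow (suc fuel) v (u′ ∷ rest) v∈s u l len | w , w∈s , vw , w≢prev | yes (there (there p)) =
      v , u′ ∷ prefixTo p , s≤s (s≤s (prefixTo-nonempty p)) , Unique-prefixTo u (there (there p)) ,
      Linked-prefixTo-∷ʳ l (there (there p)) (trans (symmetric w v) vw)

    min-degree-two⇒cycle : ∀ {v} → s v ≡ true → Cycle G
    min-degree-two⇒cycle {v} v∈s = grow n v [] v∈s ([] ∷ []) [-] refl

  module _ (acyclic : Acyclic G) where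

    leaf : ∀ s {v} → s v ≡ true → ∃ λ u → s u ≡ true × degIn s u ≤ 1
    leaf s v∈s with any? (λ u → (s u ≟ᵇ true) ×-dec (degIn s u ≤? 1))
    ... | yes found = found
    ... | no ∄leaf = contradiction (min-degree-two⇒cycle s minDeg v∈s) acyclic
      where
      minDeg : ∀ u → s u ≡ true → 2 ≤ degIn s u
      minDeg u u∈s = ≰⇒> (λ deg≤1 → ∄leaf (u , u∈s , deg≤1))

    member : ∀ s {k} → size s ≡ suc k → ∃ λ v → s v ≡ true
    member s size≡ with any? (λ v → s v ≟ᵇ true)
    ... | yes found = found
    ... | no ∄v = contradiction (trans (sym size≡) (trans (sum-cong-≗ none) (∑-zero n))) λ ()
      where
      none : ∀ x → 𝟙 (s x) ≡ 0
      none x = cong 𝟙 (¬-not (λ x∈s → ∄v (x , x∈s)))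

    degSumIn-empty : ∀ s → size s ≡ 0 → degSumIn s ≡ 0
    degSumIn-empty s size≡0 = trans (sum-cong-≗ row) (∑-zero n)
      where
      outside : ∀ x → s x ≡ false
      outside x with s x in x∈s
      ... | false = refl
      ... | true  = contradiction (subst₂ _≤_ (cong 𝟙 x∈s) size≡0 (≤-∑ (𝟙 ∘ s) x)) λ ()
      row : ∀ x → ∑[ y < n ] 𝟙 (s x ∧ s y ∧ G x y) ≡ 0
      row x rewrite outside x = ∑-zero n

    -- Delete a vertex of degree ≤ 1 in s, which exists since s spans no cycle.
    degSumIn-≤ : ∀ k s → size s ≡ k → degSumIn s ≤ 2 * (k ∸ 1)
    degSumIn-≤ zero    s size≡ = ≤-reflexive (degSumIn-empty s size≡)
    degSumIn-≤ (suc k) s size≡ with leaf s (proj₂ (member s size≡))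
    ... | u , u∈s , deg≤1 = begin
      degSumIn s                            ≡⟨ degSumIn-remove u∈s ⟩
      degSumIn (remove s u) + 2 * degIn s u ≤⟨ after k size′ (degSumIn-≤ k (remove s u) size′) ⟩
      2 * k                                 ∎
      where
      open ≤-Reasoning
      size′ : size (remove s u) ≡ k
      size′ = suc-injective (trans (sym (size-remove u∈s)) size≡)
      after : ∀ k → size (remove s u) ≡ k → degSumIn (remove s u) ≤ 2 * (k ∸ 1) →
              degSumIn (remove s u) + 2 * degIn s u ≤ 2 * k
      after zero    size≡0 ih = +-mono-≤ ih (*-monoʳ-≤ 2 (subst (degIn s u ≤_) size≡0 (degIn-≤-size s u)))
      after (suc j) _      ih = ≤-trans (+-mono-≤ ih (*-monoʳ-≤ 2 deg≤1)) (≤-reflexive (double j))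
        where
        double : ∀ j → 2 * j + 2 * 1 ≡ 2 * suc j
        double = solve-∀

    ∑-deg-≤ : ∑[ x < n ] deg G x ≤ 2 * (n ∸ 1)
    ∑-deg-≤ = degSumIn-≤ n (λ _ → true) (trans (∑-const n 1) (*-identityʳ n))

toℕ≢0 : ∀ {k} {v : Fin (suc k)} → v ≢ zero → (toℕ v ≡ᵇ 0) ≡ false
toℕ≢0 {v = zero}  v≢0 = contradiction refl v≢0
toℕ≢0 {v = suc _} _   = refl

transpose-centre : ∀ {k} (v x : Fin (suc k)) → (toℕ (transpose v zero ⟨$⟩ʳ x) ≡ᵇ 0) ≡ does (x ≟ v)
transpose-centre v x with x ≟ v
... | yes _ = refl
... | no x≢v with x ≟ zero
...   | yes refl = toℕ≢0 (x≢v ∘ sym)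
...   | no x≢0   = toℕ≢0 x≢0

module _ {k} (G : Graph (suc k)) (symmetric : ∀ x y → G x y ≡ G y x) (loopless : ∀ x → G x x ≡ false)
         (acyclic : Acyclic G) where

  -- Two neighbours x, y of the dominating vertex v cannot be adjacent: v x y would be a triangle.
  dominating⇒star : ∀ v → (∀ u → u ≢ v → Adj G v u) → G ≅ star (suc k)
  dominating⇒star v dom = transpose v zero , edges
    where
    edges : ∀ x y → G x y ≡ star (suc k) (transpose v zero ⟨$⟩ʳ x) (transpose v zero ⟨$⟩ʳ y)
    edges x y rewrite transpose-centre v x | transpose-centre v y with x ≟ v | y ≟ v
    ... | yes refl | yes refl = loopless x
    ... | yes refl | no y≢v   = dom y y≢v
    ... | no x≢v   | yes refl = trans (symmetric x y) (dom x x≢v)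
    ... | no x≢v   | no y≢v with G x y in xy
    ...   | false = refl
    ...   | true with x ≟ y
    ...     | yes refl = contradiction (trans (sym xy) (loopless x)) λ ()
    ...     | no x≢y   = contradiction triangle acyclic
      where
      triangle : Cycle G
      triangle = v , x ∷ y ∷ [] , s≤s (s≤s (s≤s z≤n)) ,
                 ((x≢v ∘ sym) ∷ (y≢v ∘ sym) ∷ []) ∷ (x≢y ∷ []) ∷ [] ∷ [] ,
                 dom x x≢v ∷ xy ∷ trans (symmetric y v) (dom y y≢v) ∷ [-]

  deg-≤-non-star : ¬ (G ≅ star (suc k)) → ∀ v → deg G v ≤ suc k ∸ 2
  deg-≤-non-star non-star v with any? (λ u → ¬? (u ≟ v) ×-dec (G v u ≟ᵇ false))
  ... | no ∄u = contradiction (dominating⇒star v (λ u u≢v → ¬-not (λ vu → ∄u (u , u≢v , vu)))) non-star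
  ... | yes (u , u≢v , vu) = m+n≤o⇒m≤o∸n (deg G v) (begin
    deg G v + (1 + 1)
      ≡⟨ cong (deg G v +_) (sym (cong₂ _+_ (∑-δ v (λ _ → 1)) (∑-δ u (λ _ → 1)))) ⟩
    deg G v + (∑[ y < suc k ] (𝟙 (does (y ≟ v)) * 1) + ∑[ y < suc k ] (𝟙 (does (y ≟ u)) * 1))
      ≡⟨ cong (deg G v +_) (sym (∑-distrib-+ (λ y → 𝟙 (does (y ≟ v)) * 1) (λ y → 𝟙 (does (y ≟ u)) * 1))) ⟩
    deg G v + ∑[ y < suc k ] (𝟙 (does (y ≟ v)) * 1 + 𝟙 (does (y ≟ u)) * 1)
      ≡⟨ sym (∑-distrib-+ (λ y → 𝟙 (G v y)) (λ y → 𝟙 (does (y ≟ v)) * 1 + 𝟙 (does (y ≟ u)) * 1)) ⟩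
    ∑[ y < suc k ] (𝟙 (G v y) + (𝟙 (does (y ≟ v)) * 1 + 𝟙 (does (y ≟ u)) * 1))
      ≤⟨ ∑-mono-≤ at-most-one ⟩
    ∑[ y < suc k ] 1
      ≡⟨ trans (∑-const (suc k) 1) (*-identityʳ _) ⟩
    suc k ∎)
    where
    open ≤-Reasoning
    at-most-one : ∀ y → 𝟙 (G v y) + (𝟙 (does (y ≟ v)) * 1 + 𝟙 (does (y ≟ u)) * 1) ≤ 1
    at-most-one y with y ≟ v
    ... | yes refl rewrite loopless y | dec-false (y ≟ u) (u≢v ∘ sym) = ≤-refl
    ... | no _ with y ≟ u
    ...   | yes refl rewrite vu = ≤-refl
    ...   | no _ with G v y
    ...     | true  = ≤-refl
    ...     | false = z≤n

deg-pos : ∀ {k} (G : Graph (2 + k)) → Connected G → ∀ x → 1 ≤ deg G x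
deg-pos {k} G connected x = first-edge (connected x (other x)) (other-≢ x)
  where
  other : Fin (2 + k) → Fin (2 + k)
  other zero    = suc zero
  other (suc _) = zero
  other-≢ : ∀ x → x ≢ other x
  other-≢ zero    ()
  other-≢ (suc _) ()
  first-edge : ∀ {y} → Walk G x y → x ≢ y → 1 ≤ deg G x
  first-edge nil                 x≢x = contradiction refl x≢x
  first-edge (cons {y = z} xz _) _   = subst (_≤ deg G x) (cong 𝟙 xz) (≤-∑ (λ y → 𝟙 (G x y)) z)

-- Weight sums of non-star trees

module _ {n} (G : Graph n) (symmetric : ∀ x y → G x y ≡ G y x) (loopless : ∀ x → G x x ≡ false) where

  private
    D Q : ℕ
    D = ∑[ x < n ] deg G x
    Q = ∑[ x < n ] (deg G x * deg G x)

  -- On the diagonal both sides equal 2 + deg x (as common x x = deg x), so the bound sums over all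
  -- ordered pairs without truncated subtraction.
  pair-bound : ∀ x y → 𝟙 (not (does (y ≟ x))) * pairWeight G x y + 𝟙 (does (y ≟ x)) * (2 + deg G x)
                       ≤ 2 + 4 * 𝟙 (G x y) + common G x y
  pair-bound x y with y ≟ x
  ... | yes refl rewrite loopless y | common-diag G symmetric y = ≤-reflexive (+-identityʳ _)
  ... | no _ = subst (_≤ 2 + 4 * 𝟙 (G x y) + common G x y) (sym (trans (+-identityʳ _) (+-identityʳ _)))
                     (distWeight-≤ (G x y) (common G x y))

  offDiagSum-pairWeight-bound : offDiagSum (pairWeight G) + (n * 2 + D) ≤ n * (n * 2) + 4 * D + Q
  offDiagSum-pairWeight-bound = begin
    offDiagSum (pairWeight G) + (n * 2 + D)
      ≡⟨ cong (offDiagSum (pairWeight G) +_) (trans (cong (_+ D) (sym (∑-const n 2))) (sym (∑-distrib-+ (λ _ → 2) (deg G)))) ⟩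
    offDiagSum (pairWeight G) + ∑[ x < n ] (2 + deg G x)
      ≡⟨ cong (offDiagSum (pairWeight G) +_) (sum-cong-≗ (λ x → sym (∑-δ x (λ _ → 2 + deg G x)))) ⟩
    ∑[ x < n ] ∑[ y < n ] off x y + ∑[ x < n ] ∑[ y < n ] diag x y
      ≡⟨ sym (∑-distrib-+ (λ x → ∑[ y < n ] off x y) (λ x → ∑[ y < n ] diag x y)) ⟩
    ∑[ x < n ] (∑[ y < n ] off x y + ∑[ y < n ] diag x y)
      ≡⟨ sum-cong-≗ (λ x → sym (∑-distrib-+ (off x) (diag x))) ⟩
    ∑[ x < n ] ∑[ y < n ] (off x y + diag x y)
      ≤⟨ ∑-mono-≤ (λ x → ∑-mono-≤ (pair-bound x)) ⟩
    ∑[ x < n ] ∑[ y < n ] (2 + 4 * 𝟙 (G x y) + common G x y)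
      ≡⟨ sum-cong-≗ (λ x → row x) ⟩
    ∑[ x < n ] (n * 2 + 4 * deg G x + ∑[ y < n ] common G x y)
      ≡⟨ ∑-distrib-+ (λ x → n * 2 + 4 * deg G x) (λ x → ∑[ y < n ] common G x y) ⟩
    ∑[ x < n ] (n * 2 + 4 * deg G x) + ∑[ x < n ] ∑[ y < n ] common G x y
      ≡⟨ cong₂ _+_ (trans (∑-distrib-+ (λ _ → n * 2) (λ x → 4 * deg G x))
                          (cong₂ _+_ (∑-const n (n * 2)) (sym (*-distribˡ-sum 4 (deg G)))))
                   (∑∑-common G symmetric) ⟩
    n * (n * 2) + 4 * D + Q ∎
    where
    open ≤-Reasoning
    off diag : Fin n → Fin n → ℕ
    off  x y = 𝟙 (not (does (y ≟ x))) * pairWeight G x y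
    diag x y = 𝟙 (does (y ≟ x)) * (2 + deg G x)
    row : ∀ x → ∑[ y < n ] (2 + 4 * 𝟙 (G x y) + common G x y) ≡ n * 2 + 4 * deg G x + ∑[ y < n ] common G x y
    row x = trans (∑-distrib-+ (λ y → 2 + 4 * 𝟙 (G x y)) (common G x))
                  (cong (_+ ∑[ y < n ] common G x y) (trans (∑-distrib-+ (λ _ → 2) (λ y → 4 * 𝟙 (G x y)))
                                      (cong₂ _+_ (∑-const n 2) (sym (*-distribˡ-sum 4 (λ y → 𝟙 (G x y)))))))

  offDiagSum-pairWeight-≤ : 3 ≤ n → (∀ x → 1 ≤ deg G x) → (∀ x → deg G x ≤ n ∸ 2) → D ≤ 2 * (n ∸ 1) →
                            offDiagSum (pairWeight G) ≤ 3 * (n * n) + n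
  offDiagSum-pairWeight-≤ 3≤n 1≤deg deg≤ D≤ = +-cancelʳ-≤ (n * 2 + D) _ _ (begin
    offDiagSum (pairWeight G) + (n * 2 + D) ≤⟨ offDiagSum-pairWeight-bound ⟩
    n * (n * 2) + 4 * D + Q                 ≡⟨ regroup n D Q ⟩
    n * (n * 2) + D + (3 * D + Q)           ≤⟨ +-monoʳ-≤ (n * (n * 2) + D)
                                                 (degree-sequence-bound 3≤n (deg G) 1≤deg deg≤ D≤) ⟩
    n * (n * 2) + D + (n * n + 3 * n)       ≡⟨ regroup′ n D ⟩
    3 * (n * n) + n + (n * 2 + D)           ∎)
    where
    open ≤-Reasoning
    regroup : ∀ n D Q → n * (n * 2) + 4 * D + Q ≡ n * (n * 2) + D + (3 * D + Q)
    regroup = solve-∀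
    regroup′ : ∀ n D → n * (n * 2) + D + (n * n + 3 * n) ≡ 3 * (n * n) + n + (n * 2 + D)
    regroup′ = solve-∀

non-star-tree-upperSum-≤ : ∀ k (T : Graph (3 + k)) → IsTree T → ¬ (T ≅ star (3 + k)) →
                           2 * upperSum (pairWeight T) ≤ 3 * ((3 + k) * (3 + k)) + (3 + k)
non-star-tree-upperSum-≤ k T ((symmetric , loopless) , connected , acyclic) non-star = begin
  2 * upperSum (pairWeight T)   ≡⟨ offDiagSum≡2*upperSum (pairWeight-sym T symmetric) ⟨
  offDiagSum (pairWeight T)     ≤⟨ offDiagSum-pairWeight-≤ T symmetric loopless (s≤s (s≤s (s≤s z≤n)))
                                     (deg-pos T connected)
                                     (deg-≤-non-star T symmetric loopless acyclic non-star)
                                     (Induced.∑-deg-≤ T symmetric loopless acyclic) ⟩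
  3 * ((3 + k) * (3 + k)) + (3 + k) ∎
  where open ≤-Reasoning

sixth : ℕ → ℚ
sixth k = ℤ.+ k / 6

+/-≤ : ∀ a b c d → a * suc d ≤ c * suc b → ℤ.+ a / suc b ≤ℚ ℤ.+ c / suc d
+/-≤ a b c d ad≤cb = toℚᵘ-cancel-≤
  (ℚᵘ.≤-respˡ-≃ (ℚᵘ.≃-sym (toℚᵘ-fromℚᵘ (mkℚᵘ (ℤ.+ a) b)))
  (ℚᵘ.≤-respʳ-≃ (ℚᵘ.≃-sym (toℚᵘ-fromℚᵘ (mkℚᵘ (ℤ.+ c) d)))
  (*≤* (subst₂ ℤ._≤_ (ℤ.pos-* a (suc d)) (ℤ.pos-* c (suc b)) (ℤ.+≤+ ad≤cb)))))

sixth-+ : ∀ a c → sixth (a + c) ≡ sixth a +ℚ sixth c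
sixth-+ a c = toℚᵘ-injective (begin
  toℚᵘ (sixth (a + c))                ≈⟨ toℚᵘ-fromℚᵘ (mkℚᵘ (ℤ.+ (a + c)) 5) ⟩
  mkℚᵘ (ℤ.+ (a + c)) 5                ≈⟨ *≡* (trans (cong (ℤ._* ℤ.+ 36) (ℤ.pos-+ a c)) (common-denominator (ℤ.+ a) (ℤ.+ c))) ⟩
  mkℚᵘ (ℤ.+ a) 5 +ᵘ mkℚᵘ (ℤ.+ c) 5  ≈⟨ ℚᵘ.+-cong (toℚᵘ-fromℚᵘ (mkℚᵘ (ℤ.+ a) 5)) (toℚᵘ-fromℚᵘ (mkℚᵘ (ℤ.+ c) 5)) ⟨
  toℚᵘ (sixth a) +ᵘ toℚᵘ (sixth c)  ≈⟨ toℚᵘ-homo-+ (sixth a) (sixth c) ⟨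
  toℚᵘ (sixth a +ℚ sixth c)           ∎)
  where
  open ℚᵘ.≃-Reasoning
  common-denominator : ∀ (a c : ℤ) → (a ℤ.+ c) ℤ.* ℤ.+ 36 ≡ (a ℤ.* ℤ.+ 6 ℤ.+ c ℤ.* ℤ.+ 6) ℤ.* ℤ.+ 6
  common-denominator = ℤ-solve-∀

sixth-mono : ∀ {a b} → a ≤ b → sixth a ≤ℚ sixth b
sixth-mono {a} {b} a≤b = +/-≤ a 5 b 5 (*-monoˡ-≤ 6 a≤b)

inv≤sixth : ∀ {d} w → 6 ≤ w * d → inv d ≤ℚ sixth w
inv≤sixth {zero}  w 6≤w*0 = contradiction (subst (6 ≤_) (*-zeroʳ w) 6≤w*0) λ ()
inv≤sixth {suc d} w 6≤w*d = +/-≤ 1 d w 5 6≤w*d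

sixth≤inv : ∀ {d} w → 1 ≤ d → w * d ≤ 6 → sixth w ≤ℚ inv d
sixth≤inv {suc d} w _ w*d≤6 = +/-≤ w 5 1 d w*d≤6

sumℚ-tabulate-≤ : ∀ {n} {f : Fin n → ℚ} {g} → (∀ i → f i ≤ℚ sixth (g i)) → sumℚ (tabulate f) ≤ℚ sixth (sum g)
sumℚ-tabulate-≤ {zero}  _ = ℚ.≤-refl
sumℚ-tabulate-≤ {suc n} {g = g} f≤g = subst (_ ≤ℚ_) (sym (sixth-+ (g zero) (sum (g ∘ suc))))
  (ℚ.+-mono-≤ (f≤g zero) (sumℚ-tabulate-≤ (f≤g ∘ suc)))

sumℚ-tabulate-≥ : ∀ {n} {f : Fin n → ℚ} {g} → (∀ i → sixth (g i) ≤ℚ f i) → sixth (sum g) ≤ℚ sumℚ (tabulate f)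
sumℚ-tabulate-≥ {zero}  _ = ℚ.≤-refl
sumℚ-tabulate-≥ {suc n} {g = g} g≤f = subst (_≤ℚ _) (sym (sixth-+ (g zero) (sum (g ∘ suc))))
  (ℚ.+-mono-≤ (g≤f zero) (sumℚ-tabulate-≥ (g≤f ∘ suc)))

module _ {n} (f : Fin n → ℚ) (g : Fin n → ℕ) where

  sumℚ-allFin-≤ : (∀ i → f i ≤ℚ sixth (g i)) → sumℚ (map f (allFin n)) ≤ℚ sixth (sum g)
  sumℚ-allFin-≤ f≤g rewrite map-tabulate id f = sumℚ-tabulate-≤ f≤g

  sumℚ-allFin-≥ : (∀ i → sixth (g i) ≤ℚ f i) → sixth (sum g) ≤ℚ sumℚ (map f (allFin n))
  sumℚ-allFin-≥ g≤f rewrite map-tabulate id f = sumℚ-tabulate-≥ g≤f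

module _ {n} (G : Graph n) (w : Fin n → Fin n → ℕ) where

  private
    term : Fin n → Fin n → ℚ
    term x y = if toℕ x <ᵇ toℕ y then inv (dist G x y) else 0ℚ

  harary-≤ : (∀ {x y} → toℕ x < toℕ y → inv (dist G x y) ≤ℚ sixth (w x y)) →
             harary G ≤ℚ sixth (upperSum w)
  harary-≤ bound = sumℚ-allFin-≤ _ _ (λ x → sumℚ-allFin-≤ (term x) (upper w x) (pointwise x))
    where
    pointwise : ∀ x y → term x y ≤ℚ sixth (upper w x y)
    pointwise x y with toℕ x <ᵇ toℕ y | <ᵇ-reflects-< (toℕ x) (toℕ y)
    ... | true  | ofʸ x<y = bound x<y
    ... | false | _       = ℚ.≤-refl

  harary-≥ : (∀ {x y} → toℕ x < toℕ y → sixth (w x y) ≤ℚ inv (dist G x y)) →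
             sixth (upperSum w) ≤ℚ harary G
  harary-≥ bound = sumℚ-allFin-≥ _ _ (λ x → sumℚ-allFin-≥ (term x) (upper w x) (pointwise x))
    where
    pointwise : ∀ x y → sixth (upper w x y) ≤ℚ term x y
    pointwise x y with toℕ x <ᵇ toℕ y | <ᵇ-reflects-< (toℕ x) (toℕ y)
    ... | true  | ofʸ x<y = bound x<y
    ... | false | _       = ℚ.≤-refl

-- The tree C_{n,3,1}

-- 6 / d(a, b) in C_{n,3,1} for a < b; vertices 4, 5, … are the pendent ones attached to 1.
c31weight : ℕ → ℕ → ℕ
c31weight 0 1 = 6
c31weight 0 2 = 3
c31weight 0 3 = 2
c31weight 0 _ = 3
c31weight 1 3 = 3
c31weight 1 _ = 6
c31weight 2 3 = 6
c31weight 2 _ = 3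
c31weight 3 _ = 2
c31weight _ _ = 3

module _ (m : ℕ) where

  private
    G = C31 (4 + m)

  c31-walk : ∀ x y → T (toℕ x <ᵇ toℕ y) → Σ (Walk G x y) λ p → c31weight (toℕ x) (toℕ y) * walkLength G p ≤ 6
  c31-walk 0F 1F _ = cons refl nil , ≤-refl
  c31-walk 0F 2F _ = cons {y = 1F} refl (cons refl nil) , ≤-refl
  c31-walk 0F 3F _ = cons {y = 1F} refl (cons {y = 2F} refl (cons refl nil)) , ≤-refl
  c31-walk 0F (suc (suc (suc (suc _)))) _ = cons {y = 1F} refl (cons refl nil) , ≤-refl
  c31-walk 1F 2F _ = cons refl nil , ≤-refl
  c31-walk 1F 3F _ = cons {y = 2F} refl (cons refl nil) , ≤-refl
  c31-walk 1F (suc (suc (suc (suc _)))) _ = cons refl nil , ≤-refl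
  c31-walk 2F 3F _ = cons refl nil , ≤-refl
  c31-walk 2F (suc (suc (suc (suc _)))) _ = cons {y = 1F} refl (cons refl nil) , ≤-refl
  c31-walk 3F (suc (suc (suc (suc _)))) _ = cons {y = 2F} refl (cons {y = 1F} refl (cons refl nil)) , ≤-refl
  c31-walk (suc (suc (suc (suc _)))) (suc (suc (suc (suc _)))) _ = cons {y = 1F} refl (cons refl nil) , ≤-refl

  c31-sixth≤inv : ∀ {x y} → toℕ x < toℕ y → sixth (c31weight (toℕ x) (toℕ y)) ≤ℚ inv (dist G x y)
  c31-sixth≤inv {x} {y} x<y with c31-walk x y (<⇒<ᵇ x<y)
  ... | p , w*len≤6 = sixth≤inv w (dist-pos G (Fin.<⇒≢ x<y))
                        (≤-trans (*-monoʳ-≤ w (dist-≤ G {walkLength G p} (reach-walk G p))) w*len≤6)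
    where
    w = c31weight (toℕ x) (toℕ y)

c31Sum : ℕ → ℕ
c31Sum N = ∑[ a < N ] ∑[ b < N ] (if toℕ a <ᵇ toℕ b then c31weight (toℕ a) (toℕ b) else 0)

c31Sum-suc : ∀ N → c31Sum (suc N) ≡ c31Sum N + ∑[ a < N ] c31weight (toℕ a) N
c31Sum-suc N = begin
  ∑[ a < suc N ] row (suc N) (toℕ a)
    ≡⟨ ∑-snoc-toℕ N (row (suc N)) ⟩
  ∑[ a < N ] row (suc N) (toℕ a) + row (suc N) N
    ≡⟨ cong₂ _+_ (sum-cong-≗ {N} (λ a → ∑-snoc-toℕ N (h (toℕ a)))) last-row ⟩
  ∑[ a < N ] (row N (toℕ a) + h (toℕ a) N) + 0
    ≡⟨ +-identityʳ _ ⟩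
  ∑[ a < N ] (row N (toℕ a) + h (toℕ a) N)
    ≡⟨ ∑-distrib-+ {N} (row N ∘ toℕ) (λ a → h (toℕ a) N) ⟩
  c31Sum N + ∑[ a < N ] h (toℕ a) N
    ≡⟨ cong (c31Sum N +_) (sum-cong-≗ {N} (λ a → cong (λ t → if t then c31weight (toℕ a) N else 0) (a<N a))) ⟩
  c31Sum N + ∑[ a < N ] c31weight (toℕ a) N
    ∎
  where
  open ≡-Reasoning
  h : ℕ → ℕ → ℕ
  h a b = if a <ᵇ b then c31weight a b else 0
  row : ℕ → ℕ → ℕ
  row M a = ∑[ b < M ] h a (toℕ b)
  a<N : ∀ (a : Fin N) → (toℕ a <ᵇ N) ≡ true
  a<N a = Equivalence.to T-≡ (<⇒<ᵇ (toℕ<n a))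
  N≮b : ∀ (b : Fin (suc N)) → (N <ᵇ toℕ b) ≢ true
  N≮b b N<b = <⇒≱ (<ᵇ⇒< N (toℕ b) (Equivalence.from T-≡ N<b)) (≤-pred (toℕ<n b))
  last-row : row (suc N) N ≡ 0
  last-row = trans (sum-cong-≗ {suc N} (λ b → cong (λ t → if t then c31weight N (toℕ b) else 0) (¬-not (N≮b b))))
                   (∑-zero (suc N))

c31Sum-closed : ∀ m → 2 * c31Sum (4 + m) ≡ 3 * ((4 + m) * (4 + m)) + (4 + m)
c31Sum-closed zero    = refl
c31Sum-closed (suc m) = begin
  2 * c31Sum (5 + m)                                    ≡⟨ cong (2 *_) (c31Sum-suc (4 + m)) ⟩
  2 * (c31Sum (4 + m) + (14 + ∑[ a < m ] 3))            ≡⟨ cong (λ t → 2 * (c31Sum (4 + m) + (14 + t))) (∑-const m 3) ⟩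
  2 * (c31Sum (4 + m) + (14 + m * 3))                   ≡⟨ *-distribˡ-+ 2 (c31Sum (4 + m)) _ ⟩
  2 * c31Sum (4 + m) + 2 * (14 + m * 3)                 ≡⟨ cong (_+ 2 * (14 + m * 3)) (c31Sum-closed m) ⟩
  3 * ((4 + m) * (4 + m)) + (4 + m) + 2 * (14 + m * 3)  ≡⟨ step m ⟩
  3 * ((5 + m) * (5 + m)) + (5 + m)                     ∎
  where
  open ≡-Reasoning
  step : ∀ m → 3 * ((4 + m) * (4 + m)) + (4 + m) + 2 * (14 + m * 3) ≡ 3 * ((5 + m) * (5 + m)) + (5 + m)
  step = solve-∀

mainTheorem15 : (n : ℕ) → 4 ≤ n → (T : Graph n) → IsTree T → ¬ (T ≅ star n) →
    harary T ≤ℚ harary (C31 n)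
mainTheorem15 .(4 + m) (s≤s (s≤s (s≤s (s≤s {n = m} z≤n)))) T tree non-star =
  begin
    harary T                         ≤⟨ harary-≤ T (pairWeight T) tree-pair ⟩
    sixth (upperSum (pairWeight T))  ≤⟨ sixth-mono weights≤ ⟩
    sixth (c31Sum n)                 ≤⟨ harary-≥ (C31 n) (λ x y → c31weight (toℕ x) (toℕ y)) (c31-sixth≤inv m) ⟩
    harary (C31 n)                   ∎
  where
  open ℚ.≤-Reasoning
  n = 4 + m
  2<n : 2 < n
  2<n = s≤s (s≤s (s≤s z≤n))
  tree-pair : ∀ {x y} → toℕ x < toℕ y → inv (dist T x y) ≤ℚ sixth (pairWeight T x y)
  tree-pair {x} {y} x<y = inv≤sixth (pairWeight T x y) (pairWeight-dist T 2<n (Fin.<⇒≢ x<y))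
  weights≤ : upperSum (pairWeight T) ≤ c31Sum n
  weights≤ = *-cancelˡ-≤ {upperSum (pairWeight T)} {c31Sum n} 2
    (≤-trans (non-star-tree-upperSum-≤ (suc m) T tree non-star) (≤-reflexive (sym (c31Sum-closed m))))
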